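{- Let $G$ and $H$ be connected graphs with roots $r_G$ and $r_H$ and edge weights $\gamma,\tau$, and let $T_G$ and $T_H$ be cable-trench trees of $G$ and $H$ respectively. Let $G\wedge H$ be the graph obtained from the disjoint union of $G$ and $H$ by identifying $r_G$ with $r_H$, rooted at this identified vertex, with inherited weights. Then $T_G\wedge T_H$ (the spanning tree of $G\wedge H$ with edge set $E(T_G)\cup E(T_H)$) is a cable-trench tree of $G\wedge H$.
   Context: For a connected graph with root $r$ and edge weight functions $\gamma,\tau:E\to\mathbb{R}$, the cost of a spanning tree $T$ is $\mathrm{cost}(T)=\sum_{e\in E(T)}\tau(e)+\sum_{w}\sum_{e\in P_T(r,w)}\gamma(e)$, where $P_T(r,w)$ is the unique $r$–$w$ path in $T$. A cable-trench tree is a spanning tree of minimum cost. -}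

module Defs where

open import Data.Nat using (ℕ; zero; suc; _+_)
open import Data.Fin using (Fin; zero; suc; _↑ˡ_; _↑ʳ_; splitAt; punchOut; _≟_)
open import Data.Bool using (Bool; true; false; if_then_else_)
open import Data.Product using (Σ; _×_; _,_; proj₁; map)
open import Data.Sum using (_⊎_; [_,_]′)
open import Data.List using (List; []; _∷_)
open import Data.List.Relation.Unary.Unique.Propositional using (Unique)
open import Relation.Binary.PropositionalEquality using (_≡_)
open import Relation.Binary.Core using (Rel; _Preserves₂_⟶_⟶_)
open import Relation.Binary.Structures using (IsPreorder)
open import Algebra.Structures using (IsCommutativeMonoid)
open import Relation.Nullary using (¬_; yes; no)

-- Weights: an ordered commutative monoid (ℝ with +, 0, ≤ is an instance).

record OrderedCommMonoid : Set₁ where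
  infixl 6 _+ᵂ_
  infix 4 _≤ᵂ_
  field
    Carrier : Set
    _+ᵂ_ : Carrier → Carrier → Carrier
    0ᵂ : Carrier
    _≤ᵂ_ : Rel Carrier _
    isCommutativeMonoid : IsCommutativeMonoid _≡_ _+ᵂ_ 0ᵂ
    isPreorder : IsPreorder _≡_ _≤ᵂ_
    +-mono-≤ : _+ᵂ_ Preserves₂ _≤ᵂ_ ⟶ _≤ᵂ_ ⟶ _≤ᵂ_

record Graph (n m : ℕ) : Set where
  field
    ends : Fin m → Fin n × Fin n
open Graph public

EdgeSet : ℕ → Set
EdgeSet m = Fin m → Bool

allEdges : ∀ {m} → EdgeSet m
allEdges _ = true

Joins : ∀ {n m} → Graph n m → Fin m → Fin n → Fin n → Set
Joins g e u w = (ends g e ≡ (u , w)) ⊎ (ends g e ≡ (w , u))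

data Walk {n m} (g : Graph n m) (T : EdgeSet m) : Fin n → Fin n → Set where
  [] : ∀ {v} → Walk g T v v
  step : ∀ {u w v} (e : Fin m) → T e ≡ true → Joins g e u w → Walk g T w v → Walk g T u v

edgesOf : ∀ {n m} {g : Graph n m} {T : EdgeSet m} {u v} → Walk g T u v → List (Fin m)
edgesOf [] = []
edgesOf (step e _ _ p) = e ∷ edgesOf p

vertsAfter : ∀ {n m} {g : Graph n m} {T : EdgeSet m} {u v} → Walk g T u v → List (Fin n)
vertsAfter [] = []
vertsAfter (step {w = w} e _ _ p) = w ∷ vertsAfter p

NonEmpty : ∀ {n m} {g : Graph n m} {T : EdgeSet m} {u v} → Walk g T u v → Set
NonEmpty [] = Data.Empty.⊥ where import Data.Empty
NonEmpty (step _ _ _ _) = Data.Unit.⊤ where import Data.Unit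

IsPath : ∀ {n m} {g : Graph n m} {T : EdgeSet m} {u v} → Walk g T u v → Set
IsPath {u = u} p = Unique (u ∷ vertsAfter p)

IsCycle : ∀ {n m} {g : Graph n m} {T : EdgeSet m} {u} → Walk g T u u → Set
IsCycle c = NonEmpty c × Unique (edgesOf c) × Unique (vertsAfter c)

Connected : ∀ {n m} → Graph n m → Set
Connected g = ∀ u v → Walk g allEdges u v

IsSpanningTree : ∀ {n m} → Graph n m → EdgeSet m → Set
IsSpanningTree g T = (∀ u v → Walk g T u v) × (∀ u (c : Walk g T u u) → ¬ IsCycle c)

-- a choice of an r–w path in T for every vertex w
-- (in a spanning tree this path P_T(r,w) is unique)
PathFamily : ∀ {n m} → Graph n m → EdgeSet m → Fin n → Set
PathFamily g T r = ∀ w → Σ (Walk g T r w) IsPath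

module _ (M : OrderedCommMonoid) where
  open OrderedCommMonoid M

  sumFin : ∀ {k} → (Fin k → Carrier) → Carrier
  sumFin {zero} f = 0ᵂ
  sumFin {suc k} f = f zero +ᵂ sumFin (λ i → f (suc i))

  sumList : List Carrier → Carrier
  sumList [] = 0ᵂ
  sumList (x ∷ xs) = x +ᵂ sumList xs

  mapL : ∀ {A : Set} → (A → Carrier) → List A → List Carrier
  mapL f [] = []
  mapL f (x ∷ xs) = f x ∷ mapL f xs

  cost : ∀ {n m} (g : Graph n m) (γ τ : Fin m → Carrier) (r : Fin n)
         (T : EdgeSet m) → PathFamily g T r → Carrier
  cost g γ τ r T P =
    sumFin (λ e → if T e then τ e else 0ᵂ)
    +ᵂ sumFin (λ w → sumList (mapL γ (edgesOf (proj₁ (P w)))))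

  IsCableTrench : ∀ {n m} (g : Graph n m) (γ τ : Fin m → Carrier) (r : Fin n)
                  → EdgeSet m → Set
  IsCableTrench g γ τ r T =
    IsSpanningTree g T ×
    (∀ (P : PathFamily g T r) T' (P' : PathFamily g T' r)
     → IsSpanningTree g T' → cost g γ τ r T P ≤ᵂ cost g γ τ r T' P')

-- Wedge G ∧ H: vertices of G followed by vertices of H other than r_H;
-- r_H is identified with r_G.  Edges of G followed by edges of H.

joinE : ∀ {mG mH} {X : Set} → (Fin mG → X) → (Fin mH → X) → Fin (mG + mH) → X
joinE {mG} f g e = [ f , g ]′ (splitAt mG e)

embG : ∀ {nG} nH → Fin nG → Fin (nG + nH)
embG nH i = i ↑ˡ nH

embH : ∀ {nG nH} → Fin nG → Fin (suc nH) → Fin (suc nH) → Fin (nG + nH)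
embH {nG} {nH} rG rH j with rH ≟ j
... | yes _ = rG ↑ˡ nH
... | no ne = nG ↑ʳ punchOut ne

wedge : ∀ {nG mG nH mH} → Graph nG mG → Graph (suc nH) mH → Fin nG → Fin (suc nH)
        → Graph (nG + nH) (mG + mH)
wedge {nG} {mG} {nH} G H rG rH = record
  { ends = joinE (λ e → map (embG nH) (embG nH) (ends G e))
                 (λ e → map (embH rG rH) (embH rG rH) (ends H e)) }

wedgeRoot : ∀ {nG} nH → Fin nG → Fin (nG + nH)
wedgeRoot nH rG = embG nH rG

-- Every edge of G ∧ H lies in G or in H, so a walk in G ∧ H projects onto G (and
-- onto H) by contracting the edges of the other side; projection keeps paths paths
-- and cycles cycles, while walks of G and H lift back.  Hence a spanning tree T of
-- G ∧ H restricts to spanning trees of G and H, and T_G ∧ T_H is a spanning tree.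
-- Every root path of T splits into its G-part and its H-part, so
-- cost(T) = cost(T ∩ G) + cost(T ∩ H), and each summand is minimised by T_G resp. T_H.
module Submission where

open import Data.Nat using (ℕ; suc; _+_)
open import Data.Fin using (Fin; zero; suc; _↑ˡ_; _↑ʳ_; splitAt; punchIn; _≟_)
open import Data.Fin.Properties
  using (splitAt-↑ˡ; splitAt-↑ʳ; splitAt⁻¹-↑ˡ; splitAt⁻¹-↑ʳ; ↑ˡ-injective; ↑ʳ-injective;
         punchInᵢ≢i; punchOut-cong; punchOut-punchIn; punchIn-punchOut)
open import Data.Bool using (if_then_else_)
open import Data.Product using (Σ; _×_; _,_; proj₁; proj₂)
import Data.Product as Product
open import Data.Sum using (_⊎_; inj₁; inj₂; [_,_]′)
import Data.Sum as Sum
open import Data.List using (List; []; _∷_; map)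
open import Data.List.Relation.Unary.All.Properties using (All¬⇒¬Any; ¬Any⇒All¬)
open import Data.List.Relation.Unary.Any using (Any; here; there)
open import Data.List.Membership.Propositional using (_∈_; _∉_)
open import Data.List.Relation.Unary.AllPairs using (_∷_; tail)
open import Data.List.Relation.Unary.Unique.Propositional using (Unique; [])
open import Data.List.Relation.Unary.Unique.Propositional.Properties using (map⁺)
open import Data.Empty using (⊥; ⊥-elim)
open import Data.Unit using (tt)
open import Function using (_∘_; id; const)
open import Relation.Binary.PropositionalEquality
  using (_≡_; _≢_; _≗_; refl; sym; trans; cong; cong₂; subst; module ≡-Reasoning)
open import Relation.Nullary using (¬_; Dec; yes; no)
open import Algebra.Bundles using (CommutativeMonoid)
open import Algebra.Structures using (IsCommutativeMonoid)
open import Relation.Binary.Bundles using (Preorder)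
open import Defs

data Split (m n : ℕ) : Fin (m + n) → Set where
  left  : (i : Fin m) → Split m n (i ↑ˡ n)
  right : (j : Fin n) → Split m n (m ↑ʳ j)

split : ∀ m {n} (i : Fin (m + n)) → Split m n i
split m i with splitAt m i in eq
... | inj₁ a = subst (Split m _) (splitAt⁻¹-↑ˡ eq) (left a)
... | inj₂ b = subst (Split m _) (splitAt⁻¹-↑ʳ eq) (right b)

↑ˡ≢↑ʳ : ∀ {m n} (i : Fin m) (j : Fin n) → i ↑ˡ n ≢ m ↑ʳ j
↑ˡ≢↑ʳ {m} {n} i j eq
  with trans (sym (splitAt-↑ˡ m i n)) (trans (cong (splitAt m) eq) (splitAt-↑ʳ m n j))
... | ()

Fiber : ∀ {A B : Set} → (A → B) → B → Set
Fiber {A} f y = Σ A λ x → f x ≡ y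

module _ {A : Set} {x : A} {xs : List A} where

  Unique-head : Unique (x ∷ xs) → x ∉ xs
  Unique-head (x≢xs ∷ _) = All¬⇒¬Any x≢xs

  Unique-cons : x ∉ xs → Unique xs → Unique (x ∷ xs)
  Unique-cons x∉xs xs! = ¬Any⇒All¬ xs x∉xs ∷ xs!

Spans : ∀ {n m} → Graph n m → EdgeSet m → Set
Spans g T = ∀ u v → Walk g T u v

Acyclic : ∀ {n m} → Graph n m → EdgeSet m → Set
Acyclic g T = ∀ u (c : Walk g T u u) → ¬ IsCycle c

module _ {n m} {g : Graph n m} where

  Joins-image : ∀ {n′ e u w a b} (f : Fin n′ → Fin n) → ends g e ≡ (f a , f b) →
                Joins g e u w → Fiber f u × Fiber f w
  Joins-image {a = a} {b} f h (inj₁ j) =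
    (a , cong proj₁ (trans (sym h) j)) , (b , cong proj₂ (trans (sym h) j))
  Joins-image {a = a} {b} f h (inj₂ j) =
    (b , cong proj₂ (trans (sym h) j)) , (a , cong proj₁ (trans (sym h) j))

  _++ʷ_ : ∀ {T u v w} → Walk g T u v → Walk g T v w → Walk g T u w
  [] ++ʷ q = q
  step e t j p ++ʷ q = step e t j (p ++ʷ q)

  ∈-vertsAfter-last : ∀ {T u v} (p : Walk g T u v) → NonEmpty p → v ∈ vertsAfter p
  ∈-vertsAfter-last (step e t j []) _ = here refl
  ∈-vertsAfter-last (step e t j p@(step _ _ _ _)) _ = there (∈-vertsAfter-last p tt)

  closed-path-trivial : ∀ {T u} (p : Walk g T u u) → IsPath p → edgesOf p ≡ []
  closed-path-trivial [] _ = refl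
  closed-path-trivial p@(step _ _ _ _) p! = ⊥-elim (Unique-head p! (∈-vertsAfter-last p tt))

  module _ {T T′ : EdgeSet m} (T≗T′ : T ≗ T′) where

    retag : ∀ {u v} → Walk g T u v → Walk g T′ u v
    retag [] = []
    retag (step e t j p) = step e (trans (sym (T≗T′ e)) t) j (retag p)

    edgesOf-retag : ∀ {u v} (p : Walk g T u v) → edgesOf (retag p) ≡ edgesOf p
    edgesOf-retag [] = refl
    edgesOf-retag (step e t j p) = cong (e ∷_) (edgesOf-retag p)

    vertsAfter-retag : ∀ {u v} (p : Walk g T u v) → vertsAfter (retag p) ≡ vertsAfter p
    vertsAfter-retag [] = refl
    vertsAfter-retag (step {w = w} e t j p) = cong (w ∷_) (vertsAfter-retag p)

    retag-IsCycle : ∀ {u} (c : Walk g T u u) → IsCycle c → IsCycle (retag c)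
    retag-IsCycle c@(step _ _ _ _) (_ , es! , vs!) =
      tt , subst Unique (sym (edgesOf-retag c)) es! , subst Unique (sym (vertsAfter-retag c)) vs!

    retagFamily : ∀ {r} → PathFamily g T r → PathFamily g T′ r
    retagFamily {r} P w =
      retag (proj₁ (P w)) ,
      subst (Unique ∘ (r ∷_)) (sym (vertsAfter-retag (proj₁ (P w)))) (proj₂ (P w))

IsSpanningTree-≗ : ∀ {n m} {g : Graph n m} {T T′} →
                   T ≗ T′ → IsSpanningTree g T → IsSpanningTree g T′
IsSpanningTree-≗ T≗T′ (spans , acyclic) =
  (λ u v → retag T≗T′ (spans u v)) ,
  (λ u c c-cycle → acyclic u (retag T′≗T c) (retag-IsCycle T′≗T c c-cycle))
  where T′≗T = sym ∘ T≗T′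

-- Retracts

-- G sits inside W through (ι, ε), and π folds W back onto G by contracting
-- every edge of W outside the image of ε.
record Retract {n m n′ m′} (G : Graph n m) (W : Graph n′ m′) : Set where
  field
    ι : Fin n → Fin n′
    π : Fin n′ → Fin n
    π∘ι : ∀ a → π (ι a) ≡ a
    ε : Fin m → Fin m′
    ε-injective : ∀ {e f} → ε e ≡ ε f → e ≡ f
    ends-ε : ∀ e → ends W (ε e) ≡ Product.map ι ι (ends G e)
    fiber? : ∀ e′ → Dec (Fiber ε e′)
    collapse : ∀ {e′ u w} → ¬ Fiber ε e′ → Joins W e′ u w → π u ≡ π w

module Retraction {n m n′ m′} {G : Graph n m} {W : Graph n′ m′} (R : Retract G W) where
  open Retract R public

  ι-injective : ∀ {a b} → ι a ≡ ι b → a ≡ b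
  ι-injective {a} {b} eq = trans (sym (π∘ι a)) (trans (cong π eq) (π∘ι b))

  ι∘π-fixes-image : ∀ {v} → Fiber ι v → v ≡ ι (π v)
  ι∘π-fixes-image (a , refl) = cong ι (sym (π∘ι a))

  Joins-ε-target : ∀ {e u w} → Joins W (ε e) u w → w ≡ ι (π w)
  Joins-ε-target {e} j = ι∘π-fixes-image (proj₂ (Joins-image {g = W} {e = ε e} ι (ends-ε e) j))

  Joins-ε : ∀ {e a b} → Joins G e a b → Joins W (ε e) (ι a) (ι b)
  Joins-ε {e} = Sum.map (λ h → trans (ends-ε e) (cong (Product.map ι ι) h))
                        (λ h → trans (ends-ε e) (cong (Product.map ι ι) h))

  Joins-ε⁻¹ : ∀ {e u w} → Joins W (ε e) u w → Joins G e (π u) (π w)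
  Joins-ε⁻¹ {e} = Sum.map reflect reflect
    where
    π∘ι-pair : ∀ q → Product.map π π (Product.map ι ι q) ≡ q
    π∘ι-pair (x , y) = cong₂ _,_ (π∘ι x) (π∘ι y)
    reflect : ∀ {x y} → ends W (ε e) ≡ (x , y) → ends G e ≡ (π x , π y)
    reflect h = trans (sym (π∘ι-pair (ends G e))) (cong (Product.map π π) (trans (sym (ends-ε e)) h))

  lift : ∀ {T a b u v} → Walk G (T ∘ ε) a b → ι a ≡ u → ι b ≡ v → Walk W T u v
  lift [] refl refl = []
  lift (step e t j p) refl v≡ = step (ε e) t (Joins-ε j) (lift p refl v≡)

  module _ {T : EdgeSet m′} where

    edgesOf-lift : ∀ {a b u v} (p : Walk G (T ∘ ε) a b) (u≡ : ι a ≡ u) (v≡ : ι b ≡ v) →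
                   edgesOf (lift {T} p u≡ v≡) ≡ map ε (edgesOf p)
    edgesOf-lift [] refl refl = refl
    edgesOf-lift (step e t j p) refl v≡ = cong (ε e ∷_) (edgesOf-lift p refl v≡)

    vertsAfter-lift : ∀ {a b u v} (p : Walk G (T ∘ ε) a b) (u≡ : ι a ≡ u) (v≡ : ι b ≡ v) →
                      vertsAfter (lift {T} p u≡ v≡) ≡ map ι (vertsAfter p)
    vertsAfter-lift [] refl refl = refl
    vertsAfter-lift (step {w = w} e t j p) refl v≡ = cong (ι w ∷_) (vertsAfter-lift p refl v≡)

  lift-IsCycle : ∀ {T a} (c : Walk G (T ∘ ε) a a) → IsCycle c → IsCycle (lift {T} c refl refl)
  lift-IsCycle {T} c@(step _ _ _ _) (_ , es! , vs!) =
    tt , subst Unique (sym (edgesOf-lift c refl refl)) (map⁺ ε-injective es!)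
       , subst Unique (sym (vertsAfter-lift c refl refl)) (map⁺ ι-injective vs!)

  project : ∀ {T u v a b} → Walk W T u v → π u ≡ a → π v ≡ b → Walk G (T ∘ ε) a b
  project [] refl refl = []
  project (step e′ t j p) refl b≡ with fiber? e′
  ... | yes (e , refl) = step e t (Joins-ε⁻¹ j) (project p refl b≡)
  ... | no e′∉ε = project p (sym (collapse e′∉ε j)) b≡

  module _ {T : EdgeSet m′} where

    edgesOf-project-irrelevant :
      ∀ {u v a b a′ b′} (p : Walk W T u v)
        (a≡ : π u ≡ a) (b≡ : π v ≡ b) (a≡′ : π u ≡ a′) (b≡′ : π v ≡ b′) →
      edgesOf (project p a≡ b≡) ≡ edgesOf (project p a≡′ b≡′)
    edgesOf-project-irrelevant [] refl refl refl refl = refl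
    edgesOf-project-irrelevant (step e′ t j p) refl b≡ refl b≡′ with fiber? e′
    ... | yes (e , refl) = cong (e ∷_) (edgesOf-project-irrelevant p refl b≡ refl b≡′)
    ... | no _ = edgesOf-project-irrelevant p _ b≡ _ b≡′

    ∈-edgesOf-project : ∀ {u v a b e} (p : Walk W T u v) (a≡ : π u ≡ a) (b≡ : π v ≡ b) →
                        e ∈ edgesOf (project p a≡ b≡) → ε e ∈ edgesOf p
    ∈-edgesOf-project [] refl refl ()
    ∈-edgesOf-project (step e′ t j p) refl b≡ with fiber? e′
    ... | yes (e , refl) = λ where
      (here refl) → here refl
      (there e∈) → there (∈-edgesOf-project p refl b≡ e∈)
    ... | no _ = there ∘ ∈-edgesOf-project p _ b≡

    ∈-vertsAfter-project : ∀ {u v a b x} (p : Walk W T u v) (a≡ : π u ≡ a) (b≡ : π v ≡ b) →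
                           x ∈ vertsAfter (project p a≡ b≡) → ι x ∈ vertsAfter p
    ∈-vertsAfter-project [] refl refl ()
    ∈-vertsAfter-project (step e′ t j p) refl b≡ with fiber? e′
    ... | yes (e , refl) = λ where
      (here refl) → here (sym (Joins-ε-target j))
      (there x∈) → there (∈-vertsAfter-project p refl b≡ x∈)
    ... | no _ = there ∘ ∈-vertsAfter-project p _ b≡

    Unique-edgesOf-project : ∀ {u v a b} (p : Walk W T u v) (a≡ : π u ≡ a) (b≡ : π v ≡ b) →
                             Unique (edgesOf p) → Unique (edgesOf (project p a≡ b≡))
    Unique-edgesOf-project [] refl refl _ = []
    Unique-edgesOf-project (step e′ t j p) refl b≡ es! with fiber? e′
    ... | yes (e , refl) =
      Unique-cons (Unique-head es! ∘ ∈-edgesOf-project p refl b≡)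
                  (Unique-edgesOf-project p refl b≡ (tail es!))
    ... | no _ = Unique-edgesOf-project p _ b≡ (tail es!)

    Unique-vertsAfter-project : ∀ {u v a b} (p : Walk W T u v) (a≡ : π u ≡ a) (b≡ : π v ≡ b) →
                                Unique (vertsAfter p) → Unique (vertsAfter (project p a≡ b≡))
    Unique-vertsAfter-project [] refl refl _ = []
    Unique-vertsAfter-project (step e′ t j p) refl b≡ vs! with fiber? e′
    ... | yes (e , refl) =
      Unique-cons (λ πw∈ → Unique-head vs! (subst (_∈ vertsAfter p)
                                                  (sym (Joins-ε-target j))
                                                  (∈-vertsAfter-project p refl b≡ πw∈)))
                  (Unique-vertsAfter-project p refl b≡ (tail vs!))
    ... | no _ = Unique-vertsAfter-project p _ b≡ (tail vs!)

    IsPath-project : ∀ {u v a b} (p : Walk W T u v) (a≡ : π u ≡ a) (b≡ : π v ≡ b) →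
                     u ≡ ι a → IsPath p → IsPath (project p a≡ b≡)
    IsPath-project p a≡ b≡ u≡ιa p! =
      Unique-cons (λ a∈ → Unique-head p! (subst (_∈ vertsAfter p) (sym u≡ιa)
                                                 (∈-vertsAfter-project p a≡ b≡ a∈)))
                  (Unique-vertsAfter-project p a≡ b≡ (tail p!))

    NonEmpty-project : ∀ {u v a b} (p : Walk W T u v) (a≡ : π u ≡ a) (b≡ : π v ≡ b) →
                       Any (Fiber ε) (edgesOf p) → NonEmpty (project p a≡ b≡)
    NonEmpty-project (step e′ t j p) refl b≡ with fiber? e′
    ... | yes (e , refl) = const tt
    ... | no e′∉ε = λ where
      (here e′∈ε) → ⊥-elim (e′∉ε e′∈ε)
      (there f) → NonEmpty-project p _ b≡ f

  project-IsCycle : ∀ {T u} (c : Walk W T u u) → Any (Fiber ε) (edgesOf c) →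
                    IsCycle c → IsCycle (project c refl refl)
  project-IsCycle c f (_ , es! , vs!) =
    NonEmpty-project c refl refl f , Unique-edgesOf-project c refl refl es!
                                   , Unique-vertsAfter-project c refl refl vs!

  restrict-IsSpanningTree : ∀ {T} → IsSpanningTree W T → IsSpanningTree G (T ∘ ε)
  restrict-IsSpanningTree (spans , acyclic) =
    (λ a b → project (spans (ι a) (ι b)) (π∘ι a) (π∘ι b)) ,
    (λ a c c-cycle → acyclic (ι a) (lift c refl refl) (lift-IsCycle c c-cycle))

  module _ {T r a} (r≡ιa : r ≡ ι a) (P : PathFamily W T r) where

    πr≡a : π r ≡ a
    πr≡a = trans (cong π r≡ιa) (π∘ι a)

    projectPath : ∀ v → Walk G (T ∘ ε) a (π v)
    projectPath v = project (proj₁ (P v)) πr≡a refl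

    projectFamily : PathFamily G (T ∘ ε) a
    projectFamily x =
      project (proj₁ (P (ι x))) πr≡a (π∘ι x) ,
      IsPath-project (proj₁ (P (ι x))) πr≡a (π∘ι x) r≡ιa (proj₂ (P (ι x)))

    edgesOf-projectFamily : ∀ x → edgesOf (proj₁ (projectFamily x)) ≡ edgesOf (projectPath (ι x))
    edgesOf-projectFamily x = edgesOf-project-irrelevant (proj₁ (P (ι x))) _ _ _ _

    edgesOf-projectPath-trivial : ∀ {v} → π v ≡ a → edgesOf (projectPath v) ≡ []
    edgesOf-projectPath-trivial {v} πv≡a =
      trans (edgesOf-project-irrelevant (proj₁ (P v)) _ _ πr≡a πv≡a)
            (closed-path-trivial _ (IsPath-project (proj₁ (P v)) πr≡a πv≡a r≡ιa (proj₂ (P v))))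

module Weights (M : OrderedCommMonoid) where
  open OrderedCommMonoid M public
  open IsCommutativeMonoid isCommutativeMonoid public using (assoc; identityˡ; identityʳ)

  commutativeMonoid : CommutativeMonoid _ _
  commutativeMonoid = record { isCommutativeMonoid = isCommutativeMonoid }

  open import Algebra.Properties.CommutativeMonoid.Sum commutativeMonoid public
    using (sum; sum-cong-≗; sum-remove; ∑-distrib-+; sum-replicate-zero)
  open import Algebra.Properties.CommutativeSemigroup
    (CommutativeMonoid.commutativeSemigroup commutativeMonoid) public
    using (interchange; x∙yz≈y∙xz)

  ≤ᵂ-preorder : Preorder _ _ _
  ≤ᵂ-preorder = record { isPreorder = isPreorder }

  weight : ∀ {m} → (Fin m → Carrier) → List (Fin m) → Carrier
  weight γ es = sumList M (mapL M γ es)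

  trench : ∀ {m} → EdgeSet m → (Fin m → Carrier) → Fin m → Carrier
  trench T τ e = if T e then τ e else 0ᵂ

  sumFin≡sum : ∀ {k} (f : Fin k → Carrier) → sumFin M f ≡ sum f
  sumFin≡sum {0} f = refl
  sumFin≡sum {suc k} f = cong (f zero +ᵂ_) (sumFin≡sum (f ∘ suc))

  sum-++ : ∀ a b (f : Fin (a + b) → Carrier) → sum f ≡ sum (f ∘ (_↑ˡ b)) +ᵂ sum (f ∘ (a ↑ʳ_))
  sum-++ 0 b f = sym (identityˡ _)
  sum-++ (suc a) b f = trans (cong (f zero +ᵂ_) (sum-++ a b (f ∘ suc))) (sym (assoc _ _ _))

  sum-zero : ∀ {k} {f : Fin k → Carrier} → (∀ i → f i ≡ 0ᵂ) → sum f ≡ 0ᵂ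
  sum-zero {k} f≗0 = trans (sum-cong-≗ f≗0) (sum-replicate-zero k)

  cost-as-sum : ∀ {n m} (g : Graph n m) γ τ r T (P : PathFamily g T r) →
                cost M g γ τ r T P ≡ sum (trench T τ) +ᵂ sum (λ w → weight γ (edgesOf (proj₁ (P w))))
  cost-as-sum g γ τ r T P =
    cong₂ _+ᵂ_ (sumFin≡sum (trench T τ)) (sumFin≡sum (λ w → weight γ (edgesOf (proj₁ (P w)))))

  cost-≗ : ∀ {n m} (g : Graph n m) γ τ r {T T′} (T≗T′ : T ≗ T′) (P : PathFamily g T r) →
           cost M g γ τ r T P ≡ cost M g γ τ r T′ (retagFamily T≗T′ P)
  cost-≗ g γ τ r {T} {T′} T≗T′ P = cong₂ _+ᵂ_
    (sumFin-cong (λ e → cong (λ b → if b then τ e else 0ᵂ) (T≗T′ e)))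
    (sumFin-cong (λ w → cong (weight γ) (sym (edgesOf-retag T≗T′ (proj₁ (P w))))))
    where
    sumFin-cong : ∀ {k} {f h : Fin k → Carrier} → f ≗ h → sumFin M f ≡ sumFin M h
    sumFin-cong {f = f} {h} f≗h = trans (sumFin≡sum f) (trans (sum-cong-≗ f≗h) (sym (sumFin≡sum h)))

-- Gluing two retracts

module Gluing {n m n₁ m₁ n₂ m₂} {W : Graph n m} {G₁ : Graph n₁ m₁} {G₂ : Graph n₂ m₂}
              (R₁ : Retract G₁ W) (R₂ : Retract G₂ W)
              (edge-cover : ∀ e → Fiber (Retract.ε R₁) e ⊎ Fiber (Retract.ε R₂) e) where
  module R₁ = Retraction R₁
  module R₂ = Retraction R₂

  glue-Acyclic : ∀ {T} → Acyclic G₁ (T ∘ R₁.ε) → Acyclic G₂ (T ∘ R₂.ε) → Acyclic W T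
  glue-Acyclic ac₁ ac₂ u [] (() , _)
  glue-Acyclic ac₁ ac₂ u c@(step e _ _ _) c-cycle with edge-cover e
  ... | inj₁ e∈ε₁ =
    ac₁ (R₁.π u) (R₁.project c refl refl) (R₁.project-IsCycle c (here e∈ε₁) c-cycle)
  ... | inj₂ e∈ε₂ =
    ac₂ (R₂.π u) (R₂.project c refl refl) (R₂.project-IsCycle c (here e∈ε₂) c-cycle)

  glue-Spans : ∀ {T r₁ r₂} → (∀ v → Fiber R₁.ι v ⊎ Fiber R₂.ι v) → R₁.ι r₁ ≡ R₂.ι r₂ →
               Spans G₁ (T ∘ R₁.ε) → Spans G₂ (T ∘ R₂.ε) → Spans W T
  glue-Spans {T} {r₁} {r₂} vertex-cover r₁≡r₂ spans₁ spans₂ u v = toRoot u ++ʷ fromRoot v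
    where
    fromRoot : ∀ v → Walk W T (R₁.ι r₁) v
    fromRoot v with vertex-cover v
    ... | inj₁ (a , refl) = R₁.lift (spans₁ r₁ a) refl refl
    ... | inj₂ (b , refl) = R₂.lift (spans₂ r₂ b) (sym r₁≡r₂) refl
    toRoot : ∀ u → Walk W T u (R₁.ι r₁)
    toRoot u with vertex-cover u
    ... | inj₁ (a , refl) = R₁.lift (spans₁ a r₁) refl refl
    ... | inj₂ (b , refl) = R₂.lift (spans₂ b r₂) refl (sym r₁≡r₂)

  module _ (M : OrderedCommMonoid) (disjoint : ∀ {e} → Fiber R₁.ε e → Fiber R₂.ε e → ⊥)
           {γ : Fin m → OrderedCommMonoid.Carrier M} {γ₁ γ₂}
           (γ₁≗ : γ ∘ R₁.ε ≗ γ₁) (γ₂≗ : γ ∘ R₂.ε ≗ γ₂) where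
    open Weights M

    weight-project :
      ∀ {T u v a₁ b₁ a₂ b₂} (p : Walk W T u v)
        (a₁≡ : R₁.π u ≡ a₁) (b₁≡ : R₁.π v ≡ b₁) (a₂≡ : R₂.π u ≡ a₂) (b₂≡ : R₂.π v ≡ b₂) →
      weight γ (edgesOf p) ≡
      weight γ₁ (edgesOf (R₁.project p a₁≡ b₁≡)) +ᵂ weight γ₂ (edgesOf (R₂.project p a₂≡ b₂≡))
    weight-project [] refl refl refl refl = sym (identityˡ 0ᵂ)
    weight-project (step e t j p) refl b₁≡ refl b₂≡ with R₁.fiber? e | R₂.fiber? e
    ... | yes e∈ε₁ | yes e∈ε₂ = ⊥-elim (disjoint e∈ε₁ e∈ε₂)
    ... | no e∉ε₁ | no e∉ε₂ = ⊥-elim ([ e∉ε₁ , e∉ε₂ ]′ (edge-cover e))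
    ... | yes (e₁ , refl) | no _ =
      trans (cong₂ _+ᵂ_ (γ₁≗ e₁) (weight-project p refl b₁≡ _ b₂≡)) (sym (assoc _ _ _))
    ... | no _ | yes (e₂ , refl) =
      trans (cong₂ _+ᵂ_ (γ₂≗ e₂) (weight-project p _ b₁≡ refl b₂≡)) (x∙yz≈y∙xz _ _ _)

-- The wedge

module Wedge {nG mG nH mH} (G : Graph nG mG) (H : Graph (suc nH) mH)
             (rG : Fin nG) (rH : Fin (suc nH)) where

  W : Graph (nG + nH) (mG + mH)
  W = wedge G H rG rH

  root : Fin (nG + nH)
  root = wedgeRoot nH rG

  ιH : Fin (suc nH) → Fin (nG + nH)
  ιH = embH rG rH

  πG : Fin (nG + nH) → Fin nG
  πG v = [ id , const rG ]′ (splitAt nG v)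

  πH : Fin (nG + nH) → Fin (suc nH)
  πH v = [ const rH , punchIn rH ]′ (splitAt nG v)

  πG-↑ˡ : ∀ a → πG (a ↑ˡ nH) ≡ a
  πG-↑ˡ a rewrite splitAt-↑ˡ nG a nH = refl

  πG-↑ʳ : ∀ j → πG (nG ↑ʳ j) ≡ rG
  πG-↑ʳ j rewrite splitAt-↑ʳ nG nH j = refl

  πH-↑ˡ : ∀ a → πH (a ↑ˡ nH) ≡ rH
  πH-↑ˡ a rewrite splitAt-↑ˡ nG a nH = refl

  πH-↑ʳ : ∀ j → πH (nG ↑ʳ j) ≡ punchIn rH j
  πH-↑ʳ j rewrite splitAt-↑ʳ nG nH j = refl

  πG-ιH : ∀ x → πG (ιH x) ≡ rG
  πG-ιH x with rH ≟ x
  ... | yes _ = πG-↑ˡ rG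
  ... | no _ = πG-↑ʳ _

  πH-ιH : ∀ x → πH (ιH x) ≡ x
  πH-ιH x with rH ≟ x
  ... | yes refl = πH-↑ˡ rG
  ... | no rH≢x = trans (πH-↑ʳ _) (punchIn-punchOut rH≢x)

  ιH-rH : ιH rH ≡ root
  ιH-rH with rH ≟ rH
  ... | yes _ = refl
  ... | no rH≢rH = ⊥-elim (rH≢rH refl)

  ιH-punchIn : ∀ j → ιH (punchIn rH j) ≡ nG ↑ʳ j
  ιH-punchIn j with rH ≟ punchIn rH j
  ... | yes rH≡ = ⊥-elim (punchInᵢ≢i rH j (sym rH≡))
  ... | no _ = cong (nG ↑ʳ_) (trans (punchOut-cong rH refl) (punchOut-punchIn rH))

  joinE-↑ˡ : ∀ {X : Set} (f : Fin mG → X) (g : Fin mH → X) → joinE f g ∘ (_↑ˡ mH) ≗ f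
  joinE-↑ˡ f g e rewrite splitAt-↑ˡ mG e mH = refl

  joinE-↑ʳ : ∀ {X : Set} (f : Fin mG → X) (g : Fin mH → X) → joinE f g ∘ (mG ↑ʳ_) ≗ g
  joinE-↑ʳ f g e rewrite splitAt-↑ʳ mG mH e = refl

  ends-↑ˡ : ∀ e → ends W (e ↑ˡ mH) ≡ Product.map (_↑ˡ nH) (_↑ˡ nH) (ends G e)
  ends-↑ˡ = joinE-↑ˡ _ _

  ends-↑ʳ : ∀ e → ends W (mG ↑ʳ e) ≡ Product.map ιH ιH (ends H e)
  ends-↑ʳ = joinE-↑ʳ _ _

  retractG : Retract G W
  retractG = record
    { ι = _↑ˡ nH ; π = πG ; π∘ι = πG-↑ˡ
    ; ε = _↑ˡ mH ; ε-injective = ↑ˡ-injective mH _ _ ; ends-ε = ends-↑ˡ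
    ; fiber? = fiber? ; collapse = collapse }
    where
    fiber? : ∀ e → Dec (Fiber (_↑ˡ mH) e)
    fiber? e with split mG e
    ... | left a = yes (a , refl)
    ... | right b = no λ (a , a≡b) → ↑ˡ≢↑ʳ a b a≡b
    collapse : ∀ {e u w} → ¬ Fiber (_↑ˡ mH) e → Joins W e u w → πG u ≡ πG w
    collapse {e} e∉ j with split mG e
    ... | left a = ⊥-elim (e∉ (a , refl))
    ... | right b = trans (at-rG u∈ιH) (sym (at-rG w∈ιH))
      where
      at-rG : ∀ {v} → Fiber ιH v → πG v ≡ rG
      at-rG (x , refl) = πG-ιH x
      u∈ιH = proj₁ (Joins-image {g = W} {e = mG ↑ʳ b} ιH (ends-↑ʳ b) j)
      w∈ιH = proj₂ (Joins-image {g = W} {e = mG ↑ʳ b} ιH (ends-↑ʳ b) j)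

  retractH : Retract H W
  retractH = record
    { ι = ιH ; π = πH ; π∘ι = πH-ιH
    ; ε = mG ↑ʳ_ ; ε-injective = ↑ʳ-injective mG _ _ ; ends-ε = ends-↑ʳ
    ; fiber? = fiber? ; collapse = collapse }
    where
    fiber? : ∀ e → Dec (Fiber (mG ↑ʳ_) e)
    fiber? e with split mG e
    ... | left a = no λ (b , b≡a) → ↑ˡ≢↑ʳ a b (sym b≡a)
    ... | right b = yes (b , refl)
    collapse : ∀ {e u w} → ¬ Fiber (mG ↑ʳ_) e → Joins W e u w → πH u ≡ πH w
    collapse {e} e∉ j with split mG e
    ... | right b = ⊥-elim (e∉ (b , refl))
    ... | left a = trans (at-rH u∈ιG) (sym (at-rH w∈ιG))
      where
      at-rH : ∀ {v} → Fiber (_↑ˡ nH) v → πH v ≡ rH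
      at-rH (x , refl) = πH-↑ˡ x
      u∈ιG = proj₁ (Joins-image {g = W} {e = a ↑ˡ mH} (_↑ˡ nH) (ends-↑ˡ a) j)
      w∈ιG = proj₂ (Joins-image {g = W} {e = a ↑ˡ mH} (_↑ˡ nH) (ends-↑ˡ a) j)

  edge-cover : ∀ e → Fiber (_↑ˡ mH) e ⊎ Fiber (mG ↑ʳ_) e
  edge-cover e with split mG e
  ... | left a = inj₁ (a , refl)
  ... | right b = inj₂ (b , refl)

  edge-disjoint : ∀ {e} → Fiber (_↑ˡ mH) e → Fiber (mG ↑ʳ_) e → ⊥
  edge-disjoint (a , refl) (b , b≡a) = ↑ˡ≢↑ʳ a b (sym b≡a)

  vertex-cover : ∀ v → Fiber (_↑ˡ nH) v ⊎ Fiber ιH v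
  vertex-cover v with split nG v
  ... | left a = inj₁ (a , refl)
  ... | right j = inj₂ (punchIn rH j , ιH-punchIn j)

  module RG = Retraction retractG
  module RH = Retraction retractH
  open Gluing retractG retractH edge-cover

  wedge-IsSpanningTree : ∀ {T} → IsSpanningTree G (T ∘ (_↑ˡ mH)) →
                         IsSpanningTree H (T ∘ (mG ↑ʳ_)) → IsSpanningTree W T
  wedge-IsSpanningTree (spansG , acyclicG) (spansH , acyclicH) =
    glue-Spans vertex-cover (sym ιH-rH) spansG spansH , glue-Acyclic acyclicG acyclicH

  module _ {T} (P : PathFamily W T root) where

    projectFamilyG : PathFamily G (T ∘ (_↑ˡ mH)) rG
    projectFamilyG = RG.projectFamily refl P

    projectFamilyH : PathFamily H (T ∘ (mG ↑ʳ_)) rH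
    projectFamilyH = RH.projectFamily (sym ιH-rH) P

  module Cost (M : OrderedCommMonoid) (γG τG : Fin mG → OrderedCommMonoid.Carrier M)
              (γH τH : Fin mH → OrderedCommMonoid.Carrier M) where
    open Weights M

    trench-split : ∀ T → sum (trench T (joinE τG τH)) ≡
                         sum (trench (T ∘ (_↑ˡ mH)) τG) +ᵂ sum (trench (T ∘ (mG ↑ʳ_)) τH)
    trench-split T = trans (sum-++ mG mH _) (cong₂ _+ᵂ_
      (sum-cong-≗ λ a → cong (λ x → if T (a ↑ˡ mH) then x else 0ᵂ) (joinE-↑ˡ τG τH a))
      (sum-cong-≗ λ b → cong (λ x → if T (mG ↑ʳ b) then x else 0ᵂ) (joinE-↑ʳ τG τH b)))

    module _ {T} (P : PathFamily W T root) where

      cableG cableH : Fin (nG + nH) → Carrier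
      cableG v = weight γG (edgesOf (RG.projectPath refl P v))
      cableH v = weight γH (edgesOf (RH.projectPath (sym ιH-rH) P v))

      cableG-sum : sum cableG ≡ sum (λ a → weight γG (edgesOf (proj₁ (projectFamilyG P a))))
      cableG-sum = trans (sum-++ nG nH cableG) (trans (cong₂ _+ᵂ_
        (sum-cong-≗ λ a → cong (weight γG) (sym (RG.edgesOf-projectFamily refl P a)))
        (sum-zero λ j → cong (weight γG) (RG.edgesOf-projectPath-trivial refl P (πG-↑ʳ j))))
        (identityʳ _))

      cableH-sum : sum cableH ≡ sum (λ x → weight γH (edgesOf (proj₁ (projectFamilyH P x))))
      cableH-sum = begin
        sum cableH
          ≡⟨ sum-++ nG nH cableH ⟩
        sum (cableH ∘ (_↑ˡ nH)) +ᵂ sum (cableH ∘ (nG ↑ʳ_))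
          ≡⟨ cong₂ _+ᵂ_ (sum-zero cableH-↑ˡ) (sum-cong-≗ cableH-↑ʳ) ⟩
        0ᵂ +ᵂ sum (cable ∘ punchIn rH)
          ≡⟨ cong (_+ᵂ sum (cable ∘ punchIn rH)) cable-rH ⟨
        cable rH +ᵂ sum (cable ∘ punchIn rH)
          ≡⟨ sum-remove cable ⟨
        sum cable ∎
        where
        open ≡-Reasoning
        cable : Fin (suc nH) → Carrier
        cable x = weight γH (edgesOf (proj₁ (projectFamilyH P x)))
        cable-rH : cable rH ≡ 0ᵂ
        cable-rH = cong (weight γH) (closed-path-trivial _ (proj₂ (projectFamilyH P rH)))
        cableH-↑ˡ : ∀ a → cableH (a ↑ˡ nH) ≡ 0ᵂ
        cableH-↑ˡ a = cong (weight γH) (RH.edgesOf-projectPath-trivial _ P (πH-↑ˡ a))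
        cableH-↑ʳ : ∀ j → cableH (nG ↑ʳ j) ≡ cable (punchIn rH j)
        cableH-↑ʳ j = cong (weight γH) (trans (cong (edgesOf ∘ RH.projectPath _ P) (sym (ιH-punchIn j)))
                                              (sym (RH.edgesOf-projectFamily _ P _)))

      cable-split : sum (λ v → weight (joinE γG γH) (edgesOf (proj₁ (P v)))) ≡
                    sum (λ a → weight γG (edgesOf (proj₁ (projectFamilyG P a)))) +ᵂ
                    sum (λ x → weight γH (edgesOf (proj₁ (projectFamilyH P x))))
      cable-split =
        trans (sum-cong-≗ λ v → weight-project M edge-disjoint (joinE-↑ˡ γG γH) (joinE-↑ʳ γG γH)
                                               (proj₁ (P v)) _ refl _ refl)
              (trans (∑-distrib-+ cableG cableH) (cong₂ _+ᵂ_ cableG-sum cableH-sum))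

      cost-wedge : cost M W (joinE γG γH) (joinE τG τH) root T P ≡
                   cost M G γG τG rG (T ∘ (_↑ˡ mH)) (projectFamilyG P) +ᵂ
                   cost M H γH τH rH (T ∘ (mG ↑ʳ_)) (projectFamilyH P)
      cost-wedge = begin
        cost M W (joinE γG γH) (joinE τG τH) root T P
          ≡⟨ cost-as-sum W _ _ root T P ⟩
        sum (trench T (joinE τG τH)) +ᵂ sum (λ v → weight (joinE γG γH) (edgesOf (proj₁ (P v))))
          ≡⟨ cong₂ _+ᵂ_ (trench-split T) cable-split ⟩
        (trenchG +ᵂ trenchH) +ᵂ (pathsG +ᵂ pathsH)
          ≡⟨ interchange trenchG trenchH pathsG pathsH ⟩
        (trenchG +ᵂ pathsG) +ᵂ (trenchH +ᵂ pathsH)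
          ≡⟨ cong₂ _+ᵂ_ (cost-as-sum G γG τG rG _ (projectFamilyG P))
                        (cost-as-sum H γH τH rH _ (projectFamilyH P)) ⟨
        cost M G γG τG rG (T ∘ (_↑ˡ mH)) (projectFamilyG P) +ᵂ
        cost M H γH τH rH (T ∘ (mG ↑ʳ_)) (projectFamilyH P) ∎
        where
        open ≡-Reasoning
        trenchG = sum (trench (T ∘ (_↑ˡ mH)) τG)
        trenchH = sum (trench (T ∘ (mG ↑ʳ_)) τH)
        pathsG = sum (λ a → weight γG (edgesOf (proj₁ (projectFamilyG P a))))
        pathsH = sum (λ x → weight γH (edgesOf (proj₁ (projectFamilyH P x))))

proposition1 : (M : OrderedCommMonoid) →
    ∀ {nG mG nH mH} (G : Graph nG mG) (H : Graph (suc nH) mH)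
      (rG : Fin nG) (rH : Fin (suc nH))
      (γG τG : Fin mG → OrderedCommMonoid.Carrier M)
      (γH τH : Fin mH → OrderedCommMonoid.Carrier M)
      (TG : EdgeSet mG) (TH : EdgeSet mH) →
      Connected G → Connected H →
      IsCableTrench M G γG τG rG TG →
      IsCableTrench M H γH τH rH TH →
      IsCableTrench M (wedge G H rG rH) (joinE γG γH) (joinE τG τH)
        (wedgeRoot nH rG) (joinE TG TH)
proposition1 M {mG = mG} {mH = mH} G H rG rH γG τG γH τH TG TH _ _ (treeG , minG) (treeH , minH) =
  wedge-IsSpanningTree (IsSpanningTree-≗ (sym ∘ TG≗) treeG) (IsSpanningTree-≗ (sym ∘ TH≗) treeH) ,
  minimal
  where
  open Wedge G H rG rH
  open Weights M
  open Cost M γG τG γH τH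
  TG≗ = joinE-↑ˡ TG TH
  TH≗ = joinE-↑ʳ TG TH
  costW = cost M W (joinE γG γH) (joinE τG τH) root
  costG = cost M G γG τG rG
  costH = cost M H γH τH rH
  minimal : ∀ P T′ P′ → IsSpanningTree W T′ → costW (joinE TG TH) P ≤ᵂ costW T′ P′
  minimal P T′ P′ tree′ = begin
    costW (joinE TG TH) P
      ≡⟨ cost-wedge P ⟩
    costG _ (projectFamilyG P) +ᵂ costH _ (projectFamilyH P)
      ≡⟨ cong₂ _+ᵂ_ (cost-≗ G γG τG rG TG≗ (projectFamilyG P))
                    (cost-≗ H γH τH rH TH≗ (projectFamilyH P)) ⟩
    costG TG PG +ᵂ costH TH PH
      ≲⟨ +-mono-≤ (minG PG _ (projectFamilyG P′) (RG.restrict-IsSpanningTree tree′))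
                  (minH PH _ (projectFamilyH P′) (RH.restrict-IsSpanningTree tree′)) ⟩
    costG _ (projectFamilyG P′) +ᵂ costH _ (projectFamilyH P′)
      ≡⟨ cost-wedge P′ ⟨
    costW T′ P′ ∎
    where
    open import Relation.Binary.Reasoning.Preorder ≤ᵂ-preorder
    PG = retagFamily TG≗ (projectFamilyG P)
    PH = retagFamily TH≗ (projectFamilyH P)
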